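{- Let $T$ be a tableau and $a$ an integer different from all entries of $T$. Then $$\mathrm{sgn}(T\leftarrow a)=(-1)^{l+w+u}\,\mathrm{sgn}(T),$$ where $l$ is the number of entries of $T$ less than $a$, $w$ is $0$ if the new square $\mathrm{sh}(T\leftarrow a)/\mathrm{sh}(T)$ is black and $1$ if it is white, and $u$ is the number of squares of $\mathrm{sh}(T)$ lying in rows strictly above the new square.
   Context: A shape is the Ferrers diagram of an integer partition, with square $(r,c)$ in row $r$ (from the top) and column $c$; chess colouring: $(r,c)$ is black if $r+c$ is even, white if odd. A tableau on a shape is a labelling of its squares with distinct integers such that every entry is greater than its neighbours above it and to its left; $\mathrm{sh}(T)$ is its shape. The sign $\mathrm{sgn}(T)$ of a tableau is the sign of the word obtained by reading its entries row by row, left to right, top to bottom; the sign of a word of distinct integers $w_1\cdots w_k$ is $(-1)^{|\{(i,j):i<j,\,w_i>w_j\}|}$. $(T\leftarrow a)$ denotes the tableau obtained by Robinson–Schensted row insertion of $a$ into $T$; its shape has exactly one more square than $\mathrm{sh}(T)$. -}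

module Defs where

open import Data.Bool using (Bool; true; false; if_then_else_)
open import Data.Nat using (ℕ; zero; suc; _+_; _%_)
open import Data.Integer using (ℤ; -1ℤ; 1ℤ; _<_; _<?_; _*_; _^_)
open import Data.List using (List; []; _∷_; length; concat; filter; map; take)
open import Data.Nat.ListAction using (sum)
open import Data.List.Relation.Unary.Linked using (Linked)
open import Data.List.Relation.Unary.Unique.Propositional using (Unique)
open import Data.Maybe using (Maybe; just; nothing)
open import Data.Product using (_×_; _,_)
open import Data.Unit using (⊤)
open import Data.Empty using (⊥)
open import Relation.Nullary using (does; ¬_)
open import Relation.Binary.PropositionalEquality using (_≡_)

-- A tableau is represented by its list of rows, top to bottom,
-- each row listed left to right.  Rows and columns are 0-indexed here.
Tab : Set
Tab = List (List ℤ)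

-- column condition between a row and the row directly below it
-- (also forces the lower row to be no longer than the upper one)
ColOK : List ℤ → List ℤ → Set
ColOK xs [] = ⊤
ColOK [] (y ∷ ys) = ⊥
ColOK (x ∷ xs) (y ∷ ys) = (x < y) × ColOK xs ys

ColsBelow : List ℤ → Tab → Set
ColsBelow r [] = ⊤
ColsBelow r (r' ∷ _) = ColOK r r'

IsTableauShape : Tab → Set
IsTableauShape [] = ⊤
IsTableauShape (r ∷ rs) =
  (¬ (r ≡ [])) × Linked _<_ r × ColsBelow r rs × IsTableauShape rs

IsTableau : Tab → Set
IsTableau T = IsTableauShape T × Unique (concat T)

sh : Tab → List ℕ
sh T = map length T

rowLen : List ℕ → ℕ → ℕ
rowLen [] r = 0
rowLen (k ∷ ks) zero = k
rowLen (k ∷ ks) (suc r) = rowLen ks r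

InShape : List ℕ → ℕ → ℕ → Set
InShape λ' r c = c Data.Nat.< rowLen λ' r

inversions : List ℤ → ℕ
inversions [] = 0
inversions (x ∷ xs) = length (filter (λ y → y <? x) xs) + inversions xs

signOf : ℕ → ℤ
signOf n = -1ℤ ^ n

sgnWord : List ℤ → ℤ
sgnWord w = signOf (inversions w)

sgn : Tab → ℤ
sgn T = sgnWord (concat T)

insertRow : ℤ → List ℤ → List ℤ × Maybe ℤ
insertRow a [] = (a ∷ [] , nothing)
insertRow a (x ∷ xs) with does (a <? x)
... | true = (a ∷ xs , just x)
... | false with insertRow a xs
...   | (ys , m) = (x ∷ ys , m)

insert : Tab → ℤ → Tab
insert [] a = (a ∷ []) ∷ []
insert (row ∷ rows) a with insertRow a row
... | (row' , nothing) = row' ∷ rows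
... | (row' , just b) = row' ∷ insert rows b

numLess : Tab → ℤ → ℕ
numLess T a = length (filter (λ y → y <? a) (concat T))

-- colour indicator of square (r , c): 0 if black (r + c even), 1 if white.
-- With 1-indexed rows/columns this is (r+1)+(c+1) mod 2 = (r + c) mod 2.
colourW : ℕ → ℕ → ℕ
colourW r c = (r + c) % 2

squaresAbove : List ℕ → ℕ → ℕ
squaresAbove λ' r = sum (take r λ')

{-# OPTIONS --safe #-}
-- Induct on the rows, reading the word as the first row R followed by the word W
-- of the other rows.  Rows increase, so if a is appended to R it only gains the
-- inversions with the entries of W below a: l − |R| of them, and |R| is the column
-- of the new square.  If a bumps b from R = pre ++ b ∷ post, the row stays
-- increasing with a in b's place, and by induction inserting b into the other rows
-- changes their inversions by (entries of W below b) + (colour and u there) mod 2.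
-- The entries of W below b cancel against those lost by b leaving R; what is left
-- are the entries of W below a and the |post| entries b passes, which mod 2 is the
-- first row's share |pre| of l and |pre| + 1 + |post| of u plus the colour flip.
module Submission where

open import Defs
open import Data.Nat using (ℕ; zero; suc; _+_; _<_; _%_; _/_; s≤s; parity) renaming (_*_ to _*ℕ_)
open import Data.Integer using (ℤ; _*_)
open import Data.List using (List; []; _∷_; _++_; [_]; concat; length; filter)
open import Data.List.Membership.Propositional using (_∉_)
open import Relation.Nullary using (¬_; Dec; yes; no)
open import Relation.Binary.PropositionalEquality
  using (_≡_; refl; sym; trans; cong; cong₂; subst; module ≡-Reasoning)

open import Data.Empty using (⊥-elim)
open import Data.Maybe using (Maybe; just; nothing)
open import Data.Product using (_×_; _,_)
open import Function using (_∘_)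
open import Relation.Unary using (Pred; Decidable)
open import Data.List.Properties
  using (filter-++; filter-all; filter-none; filter-accept; filter-reject; length-++; ++-assoc; ++-identityʳ)
open import Data.List.Relation.Unary.All using (All; []; _∷_)
import Data.List.Relation.Unary.All as All
open import Data.List.Relation.Unary.AllPairs using (AllPairs; []; _∷_)
open import Data.List.Relation.Unary.Any using (here; there)
open import Data.List.Relation.Unary.Linked.Properties using (Linked⇒AllPairs)
open import Data.List.Relation.Unary.Unique.Propositional using (Unique)
open import Data.List.Membership.Propositional.Properties using (∈-++⁺ˡ; ∈-++⁺ʳ)
open import Data.List.Relation.Binary.Permutation.Propositional
  using (_↭_; ↭-refl; prep; module PermutationReasoning)
open import Data.List.Relation.Binary.Permutation.Propositional.Properties
  using (↭-length; filter-↭; shift; ++⁺ˡ)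
open import Data.Parity.Base as ℙ using (0ℙ; toSign)
open import Data.Parity.Properties using (+-homo-+; p+p≡0ℙ; +-identityʳ)
open import Data.Nat.DivMod using (m≡m%n+[m/n]*n)
open import Data.Nat.Tactic.RingSolver using (solve-∀)
import Data.Nat.Properties as ℕ
import Data.Integer as ℤ
import Data.Integer.Properties as ℤ

module _ {p} {P : Pred ℤ p} (P? : Decidable P) where

  count : List ℤ → ℕ
  count xs = length (filter P? xs)

  count-++ : ∀ xs ys → count (xs ++ ys) ≡ count xs + count ys
  count-++ xs ys = trans (cong length (filter-++ P? xs ys)) (length-++ (filter P? xs))

  count-all : ∀ {xs} → All P xs → count xs ≡ length xs
  count-all Pxs = cong length (filter-all P? Pxs)

  count-none : ∀ {xs} → All (λ x → ¬ P x) xs → count xs ≡ 0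
  count-none ¬Pxs = cong length (filter-none P? ¬Pxs)

  count-↭ : ∀ {xs ys} → xs ↭ ys → count xs ≡ count ys
  count-↭ xs↭ys = ↭-length (filter-↭ P? xs↭ys)

countLess : ℤ → List ℤ → ℕ
countLess a = count (ℤ._<? a)

countGreater : ℤ → List ℤ → ℕ
countGreater a = count (a ℤ.<?_)

crossInversions : List ℤ → List ℤ → ℕ
crossInversions []       ys = 0
crossInversions (x ∷ xs) ys = countLess x ys + crossInversions xs ys

inversions-++ : ∀ xs ys →
  inversions (xs ++ ys) ≡ inversions xs + crossInversions xs ys + inversions ys
inversions-++ []       ys = refl
inversions-++ (x ∷ xs) ys = begin
  countLess x (xs ++ ys) + inversions (xs ++ ys)
    ≡⟨ cong₂ _+_ (count-++ (ℤ._<? x) xs ys) (inversions-++ xs ys) ⟩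
  countLess x xs + countLess x ys + (inversions xs + crossInversions xs ys + inversions ys)
    ≡⟨ rearrange (countLess x xs) (countLess x ys) (inversions xs) (crossInversions xs ys) (inversions ys) ⟩
  countLess x xs + inversions xs + (countLess x ys + crossInversions xs ys) + inversions ys ∎
  where
  open ≡-Reasoning
  rearrange : ∀ a b c d e → a + b + (c + d + e) ≡ a + c + (b + d) + e
  rearrange = solve-∀

countLess-[-] : ∀ x y → countLess x [ y ] ≡ countGreater y [ x ]
countLess-[-] x y = by-cases (y ℤ.<? x)
  where
  by-cases : Dec (y ℤ.< x) → countLess x [ y ] ≡ countGreater y [ x ]
  by-cases (yes y<x) =
    trans (cong length (filter-accept (ℤ._<? x) y<x)) (sym (cong length (filter-accept (y ℤ.<?_) y<x)))
  by-cases (no y≮x) =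
    trans (cong length (filter-reject (ℤ._<? x) y≮x)) (sym (cong length (filter-reject (y ℤ.<?_) y≮x)))

crossInversions-∷ : ∀ xs y ys →
  crossInversions xs (y ∷ ys) ≡ countGreater y xs + crossInversions xs ys
crossInversions-∷ []       y ys = refl
crossInversions-∷ (x ∷ xs) y ys = begin
  countLess x (y ∷ ys) + crossInversions xs (y ∷ ys)
    ≡⟨ cong₂ _+_ (count-++ (ℤ._<? x) [ y ] ys) (crossInversions-∷ xs y ys) ⟩
  countLess x [ y ] + countLess x ys + (countGreater y xs + crossInversions xs ys)
    ≡⟨ cong (λ k → k + countLess x ys + (countGreater y xs + crossInversions xs ys)) (countLess-[-] x y) ⟩
  countGreater y [ x ] + countLess x ys + (countGreater y xs + crossInversions xs ys)
    ≡⟨ rearrange (countGreater y [ x ]) (countLess x ys) (countGreater y xs) (crossInversions xs ys) ⟩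
  countGreater y [ x ] + countGreater y xs + (countLess x ys + crossInversions xs ys)
    ≡⟨ cong (_+ (countLess x ys + crossInversions xs ys)) (count-++ (y ℤ.<?_) [ x ] xs) ⟨
  countGreater y (x ∷ xs) + crossInversions (x ∷ xs) ys ∎
  where
  open ≡-Reasoning
  rearrange : ∀ a b c d → a + b + (c + d) ≡ a + c + (b + d)
  rearrange = solve-∀

crossInversions-↭ : ∀ xs {ys zs} → ys ↭ zs → crossInversions xs ys ≡ crossInversions xs zs
crossInversions-↭ []       ys↭zs = refl
crossInversions-↭ (x ∷ xs) ys↭zs =
  cong₂ _+_ (count-↭ (ℤ._<? x) ys↭zs) (crossInversions-↭ xs ys↭zs)

inversions-insert : ∀ xs y ys →
  inversions (xs ++ y ∷ ys) ≡ inversions (xs ++ ys) + countGreater y xs + countLess y ys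
inversions-insert xs y ys = begin
  inversions (xs ++ y ∷ ys)
    ≡⟨ inversions-++ xs (y ∷ ys) ⟩
  inversions xs + crossInversions xs (y ∷ ys) + (countLess y ys + inversions ys)
    ≡⟨ cong (λ k → inversions xs + k + (countLess y ys + inversions ys)) (crossInversions-∷ xs y ys) ⟩
  inversions xs + (countGreater y xs + crossInversions xs ys) + (countLess y ys + inversions ys)
    ≡⟨ rearrange (inversions xs) (countGreater y xs) (crossInversions xs ys) (countLess y ys) (inversions ys) ⟩
  inversions xs + crossInversions xs ys + inversions ys + countGreater y xs + countLess y ys
    ≡⟨ cong (λ k → k + countGreater y xs + countLess y ys) (inversions-++ xs ys) ⟨
  inversions (xs ++ ys) + countGreater y xs + countLess y ys ∎
  where
  open ≡-Reasoning
  rearrange : ∀ a b c d e → a + (b + c) + (d + e) ≡ a + c + e + b + d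
  rearrange = solve-∀

inversions-++-↭ : ∀ xs {ys} y zs → ys ↭ y ∷ zs →
  inversions (xs ++ ys) + inversions zs ≡ inversions (xs ++ zs) + countGreater y xs + inversions ys
inversions-++-↭ xs {ys} y zs ys↭yzs = begin
  inversions (xs ++ ys) + inversions zs
    ≡⟨ cong (_+ inversions zs) (inversions-++ xs ys) ⟩
  inversions xs + crossInversions xs ys + inversions ys + inversions zs
    ≡⟨ cong (λ k → inversions xs + k + inversions ys + inversions zs)
         (trans (crossInversions-↭ xs ys↭yzs) (crossInversions-∷ xs y zs)) ⟩
  inversions xs + (countGreater y xs + crossInversions xs zs) + inversions ys + inversions zs
    ≡⟨ rearrange (inversions xs) (countGreater y xs) (crossInversions xs zs) (inversions ys) (inversions zs) ⟩
  inversions xs + crossInversions xs zs + inversions zs + countGreater y xs + inversions ys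
    ≡⟨ cong (λ k → k + countGreater y xs + inversions ys) (inversions-++ xs zs) ⟨
  inversions (xs ++ zs) + countGreater y xs + inversions ys ∎
  where
  open ≡-Reasoning
  rearrange : ∀ a b c d e → a + (b + c) + d + e ≡ a + c + e + b + d
  rearrange = solve-∀

inversions-between : ∀ pre z post zs →
  All (λ x → ¬ z ℤ.< x) pre → All (λ x → ¬ x ℤ.< z) post →
  inversions ((pre ++ z ∷ post) ++ zs) ≡ inversions ((pre ++ post) ++ zs) + countLess z zs
inversions-between pre z post zs z≮pre post≮z = begin
  inversions ((pre ++ z ∷ post) ++ zs)
    ≡⟨ cong inversions (++-assoc pre (z ∷ post) zs) ⟩
  inversions (pre ++ z ∷ post ++ zs)
    ≡⟨ inversions-insert pre z (post ++ zs) ⟩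
  inversions (pre ++ post ++ zs) + countGreater z pre + countLess z (post ++ zs)
    ≡⟨ cong₂ (λ g l → inversions (pre ++ post ++ zs) + g + l)
         (count-none (z ℤ.<?_) z≮pre) (count-++ (ℤ._<? z) post zs) ⟩
  inversions (pre ++ post ++ zs) + 0 + (countLess z post + countLess z zs)
    ≡⟨ cong (λ l → inversions (pre ++ post ++ zs) + 0 + (l + countLess z zs)) (count-none (ℤ._<? z) post≮z) ⟩
  inversions (pre ++ post ++ zs) + 0 + countLess z zs
    ≡⟨ cong (λ w → inversions w + 0 + countLess z zs) (++-assoc pre post zs) ⟨
  inversions ((pre ++ post) ++ zs) + 0 + countLess z zs
    ≡⟨ cong (_+ countLess z zs) (ℕ.+-identityʳ _) ⟩
  inversions ((pre ++ post) ++ zs) + countLess z zs ∎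
  where open ≡-Reasoning

data RowInsertion (a : ℤ) (R : List ℤ) : List ℤ × Maybe ℤ → Set where
  append : All (λ x → ¬ a ℤ.< x) R → RowInsertion a R (R ++ [ a ] , nothing)
  bump   : ∀ pre b post → R ≡ pre ++ b ∷ post → All (λ x → ¬ a ℤ.< x) pre → a ℤ.< b →
           RowInsertion a R (pre ++ a ∷ post , just b)

insertRow-view : ∀ a R → RowInsertion a R (insertRow a R)
insertRow-view a [] = append []
insertRow-view a (x ∷ xs) with a ℤ.<? x
... | yes a<x = bump [] x xs refl [] a<x
... | no a≮x with insertRow a xs | insertRow-view a xs
...   | _ | append a≮xs                    = append (a≮x ∷ a≮xs)
...   | _ | bump pre b post refl a≮pre a<b = bump (x ∷ pre) b post refl (a≮x ∷ a≮pre) a<b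

concat-insert-↭ : ∀ T a → concat (insert T a) ↭ a ∷ concat T
concat-insert-↭ [] a = ↭-refl
concat-insert-↭ (R ∷ rest) a with insertRow a R | insertRow-view a R
... | _ | append _ = begin
  (R ++ [ a ]) ++ concat rest ≡⟨ ++-assoc R [ a ] (concat rest) ⟩
  R ++ a ∷ concat rest        ↭⟨ shift a R (concat rest) ⟩
  a ∷ R ++ concat rest        ∎
  where open PermutationReasoning
... | _ | bump pre b post refl _ _ = begin
  (pre ++ a ∷ post) ++ concat (insert rest b) ↭⟨ ++⁺ˡ (pre ++ a ∷ post) (concat-insert-↭ rest b) ⟩
  (pre ++ a ∷ post) ++ b ∷ concat rest        ≡⟨ ++-assoc pre (a ∷ post) (b ∷ concat rest) ⟩
  pre ++ a ∷ post ++ b ∷ concat rest          ↭⟨ ++⁺ˡ pre (prep a (shift b post (concat rest))) ⟩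
  pre ++ a ∷ b ∷ post ++ concat rest          ↭⟨ shift a pre (b ∷ post ++ concat rest) ⟩
  a ∷ pre ++ b ∷ post ++ concat rest          ≡⟨ cong (a ∷_) (++-assoc pre (b ∷ post) (concat rest)) ⟨
  a ∷ (pre ++ b ∷ post) ++ concat rest        ∎
  where open PermutationReasoning

inversions-bump : ∀ pre a b post zs zs′ →
  All (λ x → ¬ a ℤ.< x) pre → a ℤ.< b → All (b ℤ.<_) post → zs′ ↭ b ∷ zs →
  inversions ((pre ++ a ∷ post) ++ zs′) + (countLess b zs + inversions zs) ≡
  inversions ((pre ++ b ∷ post) ++ zs) + length post + countLess a zs + inversions zs′
inversions-bump pre a b post zs zs′ a≮pre a<b b<post zs′↭bzs = begin
  inversions ((pre ++ a ∷ post) ++ zs′) + (countLess b zs + inversions zs)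
    ≡⟨ cong (_+ (countLess b zs + inversions zs)) new-word ⟩
  inversions ((pre ++ post) ++ zs′) + countLess a zs + (countLess b zs + inversions zs)
    ≡⟨ rearrange₁ (inversions ((pre ++ post) ++ zs′)) (countLess a zs) (countLess b zs) (inversions zs) ⟩
  inversions ((pre ++ post) ++ zs′) + inversions zs + countLess b zs + countLess a zs
    ≡⟨ cong (λ k → k + countLess b zs + countLess a zs) (inversions-++-↭ (pre ++ post) b zs zs′↭bzs) ⟩
  inversions ((pre ++ post) ++ zs) + countGreater b (pre ++ post) + inversions zs′ + countLess b zs + countLess a zs
    ≡⟨ rearrange₂ (inversions ((pre ++ post) ++ zs)) (countGreater b (pre ++ post)) (inversions zs′) (countLess b zs) (countLess a zs) ⟩
  inversions ((pre ++ post) ++ zs) + countLess b zs + countGreater b (pre ++ post) + countLess a zs + inversions zs′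
    ≡⟨ cong₂ (λ k g → k + g + countLess a zs + inversions zs′) (sym old-word) greater-b ⟩
  inversions ((pre ++ b ∷ post) ++ zs) + length post + countLess a zs + inversions zs′ ∎
  where
  open ≡-Reasoning
  b≮pre : All (λ x → ¬ b ℤ.< x) pre
  b≮pre = All.map (λ a≮x b<x → a≮x (ℤ.<-trans a<b b<x)) a≮pre
  post≮a : All (λ x → ¬ x ℤ.< a) post
  post≮a = All.map (λ b<x x<a → ℤ.<-asym b<x (ℤ.<-trans x<a a<b)) b<post
  post≮b : All (λ x → ¬ x ℤ.< b) post
  post≮b = All.map ℤ.<-asym b<post
  new-word : inversions ((pre ++ a ∷ post) ++ zs′) ≡ inversions ((pre ++ post) ++ zs′) + countLess a zs
  new-word = trans (inversions-between pre a post zs′ a≮pre post≮a)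
    (cong (inversions ((pre ++ post) ++ zs′) +_)
      (trans (count-↭ (ℤ._<? a) zs′↭bzs) (cong length (filter-reject (ℤ._<? a) (ℤ.<-asym a<b)))))
  old-word : inversions ((pre ++ b ∷ post) ++ zs) ≡ inversions ((pre ++ post) ++ zs) + countLess b zs
  old-word = inversions-between pre b post zs b≮pre post≮b
  greater-b : countGreater b (pre ++ post) ≡ length post
  greater-b = trans (count-++ (b ℤ.<?_) pre post) (cong₂ _+_ (count-none (b ℤ.<?_) b≮pre) (count-all (b ℤ.<?_) b<post))
  rearrange₁ : ∀ i l m j → i + l + (m + j) ≡ i + j + m + l
  rearrange₁ = solve-∀
  rearrange₂ : ∀ i g j m l → i + g + j + m + l ≡ i + m + g + l + j
  rearrange₂ = solve-∀

parity-+-cong : ∀ {m m′ n n′} → parity m ≡ parity m′ → parity n ≡ parity n′ →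
  parity (m + n) ≡ parity (m′ + n′)
parity-+-cong {m} {m′} {n} {n′} pm pn =
  trans (+-homo-+ m n) (trans (cong₂ ℙ._+_ pm pn) (sym (+-homo-+ m′ n′)))

parity-+-double : ∀ m n → parity (m + (n + n)) ≡ parity m
parity-+-double m n = begin
  parity (m + (n + n))             ≡⟨ +-homo-+ m (n + n) ⟩
  parity m ℙ.+ parity (n + n)      ≡⟨ cong (parity m ℙ.+_) (trans (+-homo-+ n n) (p+p≡0ℙ (parity n))) ⟩
  parity m ℙ.+ 0ℙ                  ≡⟨ +-identityʳ (parity m) ⟩
  parity m                         ∎
  where open ≡-Reasoning

parity-colourW : ∀ l r c u o →
  parity (l + colourW r c + u + o) ≡ parity (l + (r + c) + u + o)
parity-colourW l r c u o = begin
  parity (l + n % 2 + u + o)                     ≡⟨ parity-+-double (l + n % 2 + u + o) (n / 2) ⟨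
  parity (l + n % 2 + u + o + (n / 2 + n / 2))   ≡⟨ cong parity (rearrange l (n % 2) (n / 2) u o) ⟩
  parity (l + (n % 2 + n / 2 *ℕ 2) + u + o)      ≡⟨ cong (λ k → parity (l + k + u + o)) (m≡m%n+[m/n]*n n 2) ⟨
  parity (l + n + u + o)                         ∎
  where
  open ≡-Reasoning
  n : ℕ
  n = r + c
  rearrange : ∀ l m q u o → l + m + u + o + (q + q) ≡ l + (m + q *ℕ 2) + u + o
  rearrange = solve-∀

parity-substitute : ∀ n m k {v} e → n + m ≡ k + v → parity v ≡ parity (m + e) →
  parity n ≡ parity (k + e)
parity-substitute n m k {v} e n+m≡k+v v≡₂m+e = begin
  parity n                   ≡⟨ parity-+-double n m ⟨
  parity (n + (m + m))       ≡⟨ cong parity (ℕ.+-assoc n m m) ⟨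
  parity (n + m + m)         ≡⟨ cong (λ x → parity (x + m)) n+m≡k+v ⟩
  parity (k + v + m)         ≡⟨ parity-+-cong {k + v} {k + (m + e)} {m} {m} (parity-+-cong {k} {k} {v} refl v≡₂m+e) refl ⟩
  parity (k + (m + e) + m)   ≡⟨ cong parity (rearrange k m e) ⟩
  parity (k + e + (m + m))   ≡⟨ parity-+-double (k + e) m ⟩
  parity (k + e)             ∎
  where
  open ≡-Reasoning
  rearrange : ∀ k m e → k + (m + e) + m ≡ k + e + (m + m)
  rearrange = solve-∀

signOf-suc-suc : ∀ n → signOf (suc (suc n)) ≡ signOf n
signOf-suc-suc n =
  trans (cong (ℤ.-1ℤ ℤ.*_) (ℤ.-1*i≡-i (signOf n)))
    (trans (ℤ.-1*i≡-i (ℤ.- signOf n)) (ℤ.neg-involutive (signOf n)))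

signOf-parity : ∀ n → signOf n ≡ toSign (parity n) ℤ.◃ 1
signOf-parity zero          = refl
signOf-parity (suc zero)    = refl
signOf-parity (suc (suc n)) = trans (signOf-suc-suc n) (signOf-parity n)

signOf-cong : ∀ m n → parity m ≡ parity n → signOf m ≡ signOf n
signOf-cong m n pm≡pn =
  trans (signOf-parity m) (trans (cong (λ p → toSign p ℤ.◃ 1) pm≡pn) (sym (signOf-parity n)))

AllPairs-++⁻ʳ : ∀ {R : ℤ → ℤ → Set} xs {ys} → AllPairs R (xs ++ ys) → AllPairs R ys
AllPairs-++⁻ʳ []       Rys         = Rys
AllPairs-++⁻ʳ (x ∷ xs) (_ ∷ Rxsys) = AllPairs-++⁻ʳ xs Rxsys

All-≮∧∉⇒> : ∀ {a} xs → All (λ x → ¬ a ℤ.< x) xs → a ∉ xs → All (ℤ._< a) xs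
All-≮∧∉⇒> []       []           a∉[]   = []
All-≮∧∉⇒> (x ∷ xs) (a≮x ∷ a≮xs) a∉x∷xs =
  ℤ.≤∧≢⇒< (ℤ.≮⇒≥ a≮x) (λ x≡a → a∉x∷xs (here (sym x≡a))) ∷ All-≮∧∉⇒> xs a≮xs (a∉x∷xs ∘ there)

appendRow-parity : ∀ R a zs c → All (λ x → ¬ a ℤ.< x) R → a ∉ R → c ≡ length R →
  parity (inversions ((R ++ [ a ]) ++ zs)) ≡
    parity (countLess a (R ++ zs) + (0 + c) + 0 + inversions (R ++ zs))
appendRow-parity R a zs c a≮R a∉R c≡∣R∣ = begin
  parity (inversions ((R ++ [ a ]) ++ zs))
    ≡⟨ cong parity (inversions-between R a [] zs a≮R []) ⟩
  parity (inversions ((R ++ []) ++ zs) + countLess a zs)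
    ≡⟨ cong (λ w → parity (inversions (w ++ zs) + countLess a zs)) (++-identityʳ R) ⟩
  parity (inversions (R ++ zs) + countLess a zs)
    ≡⟨ parity-+-double (inversions (R ++ zs) + countLess a zs) (length R) ⟨
  parity (inversions (R ++ zs) + countLess a zs + (length R + length R))
    ≡⟨ cong parity (rearrange (inversions (R ++ zs)) (countLess a zs) (length R)) ⟩
  parity (length R + countLess a zs + (0 + length R) + 0 + inversions (R ++ zs))
    ≡⟨ cong₂ (λ l k → parity (l + (0 + k) + 0 + inversions (R ++ zs))) less-a (sym c≡∣R∣) ⟩
  parity (countLess a (R ++ zs) + (0 + c) + 0 + inversions (R ++ zs)) ∎
  where
  open ≡-Reasoning
  less-a : length R + countLess a zs ≡ countLess a (R ++ zs)
  less-a = sym (trans (count-++ (ℤ._<? a) R zs)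
    (cong (_+ countLess a zs) (count-all (ℤ._<? a) (All-≮∧∉⇒> R a≮R a∉R))))
  rearrange : ∀ o l n → o + l + (n + n) ≡ n + l + (0 + n) + 0 + o
  rearrange = solve-∀

bumpRow-parity : ∀ pre a b post zs zs′ r c u →
  All (λ x → ¬ a ℤ.< x) pre → a ∉ pre → a ℤ.< b → All (b ℤ.<_) post → zs′ ↭ b ∷ zs →
  parity (inversions zs′) ≡ parity (countLess b zs + (r + c) + u + inversions zs) →
  parity (inversions ((pre ++ a ∷ post) ++ zs′)) ≡
    parity (countLess a ((pre ++ b ∷ post) ++ zs) + (suc r + c) + (length (pre ++ b ∷ post) + u)
            + inversions ((pre ++ b ∷ post) ++ zs))
bumpRow-parity pre a b post zs zs′ r c u a≮pre a∉pre a<b b<post zs′↭bzs ih =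
  trans (parity-substitute (inversions ((pre ++ a ∷ post) ++ zs′)) (countLess b zs + inversions zs)
           old-part (r + c + u) (inversions-bump pre a b post zs zs′ a≮pre a<b b<post zs′↭bzs) ih′)
    (sym (trans (cong parity target) (parity-+-double (old-part + (r + c + u)) (suc (length pre)))))
  where
  old-part : ℕ
  old-part = inversions ((pre ++ b ∷ post) ++ zs) + length post + countLess a zs
  ih′ : parity (inversions zs′) ≡ parity (countLess b zs + inversions zs + (r + c + u))
  ih′ = trans ih (cong parity (rearrange₁ (countLess b zs) (r + c) u (inversions zs)))
    where
    rearrange₁ : ∀ l k u i → l + k + u + i ≡ l + i + (k + u)
    rearrange₁ = solve-∀
  less-a : countLess a ((pre ++ b ∷ post) ++ zs) ≡ length pre + countLess a zs
  less-a = trans (count-++ (ℤ._<? a) (pre ++ b ∷ post) zs)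
    (cong (_+ countLess a zs) (trans (count-++ (ℤ._<? a) pre (b ∷ post))
      (trans (cong₂ _+_ (count-all (ℤ._<? a) (All-≮∧∉⇒> pre a≮pre a∉pre))
        (count-none (ℤ._<? a)
          (ℤ.<-asym a<b ∷ All.map (λ b<x x<a → ℤ.<-asym b<x (ℤ.<-trans x<a a<b)) b<post)))
        (ℕ.+-identityʳ (length pre)))))
  target : countLess a ((pre ++ b ∷ post) ++ zs) + (suc r + c) + (length (pre ++ b ∷ post) + u)
             + inversions ((pre ++ b ∷ post) ++ zs) ≡
           old-part + (r + c + u) + (suc (length pre) + suc (length pre))
  target = trans (cong₂ (λ l n → l + (suc r + c) + (n + u) + inversions ((pre ++ b ∷ post) ++ zs))
                        less-a (length-++ pre))
                 (rearrange₂ (length pre) (countLess a zs) r c (length post) u (inversions ((pre ++ b ∷ post) ++ zs)))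
    where
    rearrange₂ : ∀ p l r c q u o →
      p + l + (suc r + c) + (p + suc q + u) + o ≡ o + q + l + (r + c + u) + (suc p + suc p)
    rearrange₂ = solve-∀

insert-inversions-parity : ∀ T a r c → IsTableau T → a ∉ concat T →
  InShape (sh (insert T a)) r c → ¬ InShape (sh T) r c →
  parity (inversions (concat (insert T a))) ≡
    parity (numLess T a + (r + c) + squaresAbove (sh T) r + inversions (concat T))
insert-inversions-parity [] a zero    zero    _ _ _           _ = refl
insert-inversions-parity [] a zero    (suc c) _ _ (s≤s ()) _
insert-inversions-parity [] a (suc r) c       _ _ ()          _
insert-inversions-parity (R ∷ rest) a r c ((_ , R-sorted , _ , rest-shape) , unique) a∉ new old
  with insertRow a R | insertRow-view a R | r
... | _ | append a≮R | zero =
  appendRow-parity R a (concat rest) c a≮R (a∉ ∘ ∈-++⁺ˡ)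
    (ℕ.≤∧≮⇒≡ (ℕ.m<1+n⇒m≤n (subst (c <_) (trans (length-++ R) (ℕ.+-comm (length R) 1)) new)) old)
... | _ | append _ | suc _ = ⊥-elim (old new)
... | _ | bump pre b post refl _ _ | zero =
  ⊥-elim (old (subst (c <_) (trans (length-++ pre) (sym (length-++ pre))) new))
... | _ | bump pre b post refl a≮pre a<b | suc r′ =
  bumpRow-parity pre a b post (concat rest) (concat (insert rest b)) r′ c (squaresAbove (sh rest) r′)
    a≮pre (a∉ ∘ ∈-++⁺ˡ ∘ ∈-++⁺ˡ) a<b b<post (concat-insert-↭ rest b)
    (insert-inversions-parity rest b r′ c (rest-shape , AllPairs-++⁻ʳ (pre ++ b ∷ post) unique) b∉rest new old)
  where
  b<post : All (b ℤ.<_) post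
  b<post with AllPairs-++⁻ʳ pre (Linked⇒AllPairs ℤ.<-trans R-sorted)
  ... | b<post ∷ _ = b<post
  b∉rest : b ∉ concat rest
  b∉rest b∈rest with AllPairs-++⁻ʳ pre (subst Unique (++-assoc pre (b ∷ post) (concat rest)) unique)
  ... | b≢post++rest ∷ _ = All.lookup b≢post++rest (∈-++⁺ʳ post b∈rest) refl

lemma5p2 : (T : Tab) → IsTableau T → (a : ℤ) → a ∉ concat T →
    (r c : ℕ) → InShape (sh (insert T a)) r c → ¬ InShape (sh T) r c →
    sgn (insert T a) ≡ signOf (numLess T a + colourW r c + squaresAbove (sh T) r) * sgn T
lemma5p2 T tableau a a∉T r c new old = begin
  sgn (insert T a)                   ≡⟨ signOf-cong (inversions (concat (insert T a))) (e + o) parity-eq ⟩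
  signOf (e + o)                     ≡⟨ ℤ.^-distribˡ-+-* ℤ.-1ℤ e o ⟩
  signOf e * sgn T                   ∎
  where
  open ≡-Reasoning
  l u o e : ℕ
  l = numLess T a
  u = squaresAbove (sh T) r
  o = inversions (concat T)
  e = l + colourW r c + u
  parity-eq : parity (inversions (concat (insert T a))) ≡ parity (e + o)
  parity-eq = trans (insert-inversions-parity T a r c tableau a∉T new old) (sym (parity-colourW l r c u o))
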